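{- Let $G$ be a finite abelian group with $|G|=m$ and let $A\subseteq G$ satisfy $R_A(g)\le 5$ for all $g\in G$. Then $$|\{g\in G:\ R_A(g)=2\}|\ \le\ \frac{1}{2}m+3\sqrt{5m}.$$
   Context: For a subset $A$ of an abelian group $G$ (written additively) and $g\in G$, $R_A(g)$ denotes the number of ordered pairs $(a,a')\in A\times A$ with $a+a'=g$. -}

module Defs where

open import Data.Nat using (ℕ)
open import Data.Fin using (Fin)
open import Data.Fin.Properties using (_≟_)
open import Data.Fin.Subset using (Subset; _∈_)
open import Data.Fin.Subset.Properties using (_∈?_)
open import Data.List using (List; length; filter; cartesianProduct; allFin)
open import Data.Product using (_×_; _,_)
open import Relation.Nullary using (_×-dec_)
open import Relation.Binary.PropositionalEquality using (_≡_)
open import Algebra.Structures using (IsAbelianGroup)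

-- A finite abelian group of order m, presented (up to isomorphism) as an
-- abelian group structure on the m-element set Fin m.
record FinAbGroup (m : ℕ) : Set where
  field
    _∙_ : Fin m → Fin m → Fin m
    ε   : Fin m
    _⁻¹ : Fin m → Fin m
    isAbelianGroup : IsAbelianGroup _≡_ _∙_ ε _⁻¹

R : ∀ {m} → FinAbGroup m → Subset m → Fin m → ℕ
R {m} G A g = length (filter P? (cartesianProduct (allFin m) (allFin m)))
  where
  open FinAbGroup G
  P? : (p : Fin m × Fin m) → _
  P? (a , a') = (a ∈? A) ×-dec ((a' ∈? A) ×-dec ((a ∙ a') ≟ g))

countR2 : ∀ {m} → FinAbGroup m → Subset m → ℕ
countR2 {m} G A = length (filter (λ g → Data.Nat._≟_ (R G A g) 2) (allFin m))
  where import Data.Nat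

{-# OPTIONS --safe #-}
module Submission where

-- Write N = |A| and E = Σ_g R(g)² for the additive energy of A. On 0 ≤ r ≤ 5 the
-- inequality 4·[r = 2] + r² ≤ 4r + 5·[r = 5] holds, so summing it over G gives
-- 4·#{R = 2} + E ≤ 4N² + 5·#{R = 5}. Counting solutions of a + b = c + d by the
-- difference d - a gives E = Σ_x T(x)², where T(x) = #{h ∈ A : x + h ∈ A}; since
-- T(0) = N, Σ T = N² and T² ≥ 3T - 2 on ℕ, E ≥ 4N² - 3N - 2m. An odd R(g) forces
-- g = 2a for some a ∈ A, so #{R = 5} ≤ N and hence 2·#{R = 2} ≤ m + 4N. Finally
-- N² = Σ R ≤ 5m, so (2·#{R = 2} - m)² ≤ 16N² ≤ 80m.

open import Data.Nat using (ℕ; _+_; _*_; _∸_; _≤_; _<_)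
open import Data.Fin using (Fin)
open import Data.Fin.Subset using (Subset)
open import Defs

open import Algebra.Bundles using (Group)
open import Algebra.Structures using (IsAbelianGroup)
import Algebra.Properties.Group as GroupProperties
open import Data.Bool.Base using (true; false; if_then_else_)
open import Data.Fin.Base using (zero; suc)
open import Data.Fin.Permutation using (Permutation; permutation)
open import Data.Fin.Properties using (_≟_; _<?_; <-cmp)
open import Data.Fin.Subset.Properties using (_∈?_)
open import Data.List.Base using (List; []; _∷_; _++_; map; length; filter; tabulate; allFin; cartesianProduct)
open import Data.List.Properties using (map-++; map-∘; map-tabulate)
import Data.Nat as ℕ
import Data.Nat.ListAction as List
open import Data.Nat.Tactic.RingSolver using (solve-∀; solve)
open import Data.Nat.ListAction.Properties using (sum-++)
open import Data.Nat.Properties hiding (_≟_; _<?_; <-cmp)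
open import Algebra.Properties.Semiring.Sum +-*-semiring
open import Data.Product using (_×_; _,_; ∃-syntax)
open import Function using (_∘_; id)
open import Level using (Level)
open import Relation.Binary.Definitions using (tri<; tri≈; tri>)
open import Relation.Binary.PropositionalEquality
open import Relation.Nullary using (Dec; yes; no; does; ¬_; _×-dec_; contradiction)
open import Relation.Unary using (Pred; Decidable)

private
  variable
    p q : Level
    P : Set p
    Q : Set q
    n : ℕ

𝟙 : Dec P → ℕ
𝟙 d = if does d then 1 else 0

𝟙-yes : (d : Dec P) → P → 𝟙 d ≡ 1
𝟙-yes (yes _) _ = refl
𝟙-yes (no ¬p) p = contradiction p ¬p

𝟙-no : (d : Dec P) → ¬ P → 𝟙 d ≡ 0
𝟙-no (yes p) ¬p = contradiction p ¬p
𝟙-no (no _)  _  = refl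

𝟙-cong : (d : Dec P) (e : Dec Q) → (P → Q) → (Q → P) → 𝟙 d ≡ 𝟙 e
𝟙-cong (yes p) e to _    = sym (𝟙-yes e (to p))
𝟙-cong (no ¬p) e _  from = sym (𝟙-no e (¬p ∘ from))

𝟙-× : (d : Dec P) (e : Dec Q) → 𝟙 (d ×-dec e) ≡ 𝟙 d * 𝟙 e
𝟙-× (yes _) (yes _) = refl
𝟙-× (yes _) (no _)  = refl
𝟙-× (no _)  _       = refl

𝟙-idem : (d : Dec P) → 𝟙 d * 𝟙 d ≡ 𝟙 d
𝟙-idem (yes _) = refl
𝟙-idem (no _)  = refl

𝟙-≤ : ∀ {k} (d : Dec P) → (P → 0 < k) → 𝟙 d ≤ k
𝟙-≤ (yes p) 0<k = 0<k p
𝟙-≤ (no _)  _   = ℕ.z≤n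

length-filter≡sum-𝟙 : ∀ {a} {A : Set a} {P : Pred A p} (P? : Decidable P) (xs : List A) →
                      length (filter P? xs) ≡ List.sum (map (𝟙 ∘ P?) xs)
length-filter≡sum-𝟙 P? []       = refl
length-filter≡sum-𝟙 P? (x ∷ xs) with does (P? x)
... | true  = cong ℕ.suc (length-filter≡sum-𝟙 P? xs)
... | false = length-filter≡sum-𝟙 P? xs

sum-cartesianProduct : ∀ {a b} {A : Set a} {B : Set b} (f : A × B → ℕ) (xs : List A) (ys : List B) →
                       List.sum (map f (cartesianProduct xs ys)) ≡
                       List.sum (map (λ x → List.sum (map (λ y → f (x , y)) ys)) xs)
sum-cartesianProduct f []       ys = refl
sum-cartesianProduct f (x ∷ xs) ys = begin
  List.sum (map f (map (x ,_) ys ++ cartesianProduct xs ys))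
    ≡⟨ cong List.sum (map-++ f (map (x ,_) ys) _) ⟩
  List.sum (map f (map (x ,_) ys) ++ map f (cartesianProduct xs ys))
    ≡⟨ sum-++ (map f (map (x ,_) ys)) _ ⟩
  List.sum (map f (map (x ,_) ys)) + List.sum (map f (cartesianProduct xs ys))
    ≡⟨ cong₂ _+_ (cong List.sum (sym (map-∘ ys))) (sum-cartesianProduct f xs ys) ⟩
  List.sum (map (λ y → f (x , y)) ys) + List.sum (map (λ x → List.sum (map (λ y → f (x , y)) ys)) xs)
    ∎
  where open ≡-Reasoning

sum-tabulate : (f : Fin n → ℕ) → List.sum (tabulate f) ≡ sum f
sum-tabulate {ℕ.zero}  f = refl
sum-tabulate {ℕ.suc n} f = cong (f zero +_) (sum-tabulate (f ∘ suc))

sum-map-allFin : (f : Fin n → ℕ) → List.sum (map f (allFin n)) ≡ sum f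
sum-map-allFin f = trans (cong List.sum (map-tabulate id f)) (sum-tabulate f)

length-filter-allFin : {P : Pred (Fin n) p} (P? : Decidable P) →
                       length (filter P? (allFin n)) ≡ ∑[ i < n ] 𝟙 (P? i)
length-filter-allFin {n} P? = trans (length-filter≡sum-𝟙 P? (allFin n)) (sum-map-allFin (𝟙 ∘ P?))

length-filter-allFin² : ∀ {m} {P : Pred (Fin m × Fin n) p} (P? : Decidable P) →
                        length (filter P? (cartesianProduct (allFin m) (allFin n))) ≡
                        ∑[ i < m ] ∑[ j < n ] 𝟙 (P? (i , j))
length-filter-allFin² {n} {m = m} P? = begin
  length (filter P? (cartesianProduct (allFin m) (allFin n)))
    ≡⟨ length-filter≡sum-𝟙 P? (cartesianProduct (allFin m) (allFin n)) ⟩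
  List.sum (map (𝟙 ∘ P?) (cartesianProduct (allFin m) (allFin n)))
    ≡⟨ sum-cartesianProduct (𝟙 ∘ P?) (allFin m) (allFin n) ⟩
  List.sum (map (λ i → List.sum (map (λ j → 𝟙 (P? (i , j))) (allFin n))) (allFin m))
    ≡⟨ trans (sum-map-allFin (λ i → List.sum (map (λ j → 𝟙 (P? (i , j))) (allFin n))))
             (sum-cong-≗ λ i → sum-map-allFin (λ j → 𝟙 (P? (i , j)))) ⟩
  ∑[ i < m ] ∑[ j < n ] 𝟙 (P? (i , j))
    ∎
  where open ≡-Reasoning

∑-mono-≤ : {f g : Fin n → ℕ} → (∀ i → f i ≤ g i) → sum f ≤ sum g
∑-mono-≤ {ℕ.zero}  _   = ℕ.z≤n
∑-mono-≤ {ℕ.suc n} f≤g = +-mono-≤ (f≤g zero) (∑-mono-≤ (f≤g ∘ suc))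

∑-const : ∀ n k → ∑[ i < n ] k ≡ n * k
∑-const ℕ.zero    k = refl
∑-const (ℕ.suc n) k = cong (k +_) (∑-const n k)

∑-*ˡ-+ : ∀ k (f g : Fin n → ℕ) → ∑[ i < n ] (k * f i + g i) ≡ k * sum f + sum g
∑-*ˡ-+ k f g = trans (∑-distrib-+ _ g) (cong (_+ sum g) (sym (*-distribˡ-sum k f)))

δ : Fin n → Fin n → ℕ
δ i j = 𝟙 (i ≟ j)

∑-δ : (i : Fin n) → sum (δ i) ≡ 1
∑-δ {ℕ.suc n} zero = cong ℕ.suc (sum-replicate-zero n)
∑-δ {ℕ.suc n} (suc i) = ∑-δ i

∑-δ-* : (i : Fin n) (f : Fin n → ℕ) → ∑[ j < n ] (δ j i * f j) ≡ f i
∑-δ-* {ℕ.suc n} zero    f =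
  trans (cong₂ _+_ (+-identityʳ (f zero)) (sum-replicate-zero n)) (+-identityʳ (f zero))
∑-δ-* {ℕ.suc n} (suc i) f = ∑-δ-* i (f ∘ suc)

∑∑-symmetric : (X : Fin n → Fin n → ℕ) → (∀ a b → X a b ≡ X b a) →
               ∑[ a < n ] ∑[ b < n ] X a b ≡
               ∑[ a < n ] X a a + 2 * ∑[ a < n ] ∑[ b < n ] (𝟙 (a <? b) * X a b)
∑∑-symmetric {n} X X-sym = begin
  ∑[ a < n ] ∑[ b < n ] X a b
    ≡⟨ sum-cong-≗ row ⟩
  ∑[ a < n ] (X a a + (upper a + lower a))
    ≡⟨ trans (∑-distrib-+ (λ a → X a a) (λ a → upper a + lower a))
             (cong (∑[ a < n ] X a a +_) (∑-distrib-+ upper lower)) ⟩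
  ∑[ a < n ] X a a + (sum upper + sum lower)
    ≡⟨ cong (λ t → ∑[ a < n ] X a a + (sum upper + t)) lower≡upper ⟩
  ∑[ a < n ] X a a + (sum upper + sum upper)
    ≡⟨ cong (∑[ a < n ] X a a +_) (cong (sum upper +_) (sym (+-identityʳ (sum upper)))) ⟩
  ∑[ a < n ] X a a + 2 * sum upper
    ∎
  where
  open ≡-Reasoning
  upper lower : Fin n → ℕ
  upper a = ∑[ b < n ] (𝟙 (a <? b) * X a b)
  lower a = ∑[ b < n ] (𝟙 (b <? a) * X a b)

  trichotomy : ∀ a b → δ b a + (𝟙 (a <? b) + 𝟙 (b <? a)) ≡ 1
  trichotomy a b with <-cmp a b
  ... | tri< a<b a≢b b≮a
    rewrite 𝟙-no (b ≟ a) (a≢b ∘ sym) | 𝟙-yes (a <? b) a<b | 𝟙-no (b <? a) b≮a = refl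
  ... | tri≈ a≮b a≡b b≮a
    rewrite 𝟙-yes (b ≟ a) (sym a≡b) | 𝟙-no (a <? b) a≮b | 𝟙-no (b <? a) b≮a = refl
  ... | tri> a≮b a≢b b<a
    rewrite 𝟙-no (b ≟ a) (a≢b ∘ sym) | 𝟙-no (a <? b) a≮b | 𝟙-yes (b <? a) b<a = refl

  row : ∀ a → ∑[ b < n ] X a b ≡ X a a + (upper a + lower a)
  row a = begin
    ∑[ b < n ] X a b
      ≡⟨ sum-cong-≗ split ⟩
    ∑[ b < n ] (δ b a * X a b + (𝟙 (a <? b) * X a b + 𝟙 (b <? a) * X a b))
      ≡⟨ trans (∑-distrib-+ (λ b → δ b a * X a b) (λ b → 𝟙 (a <? b) * X a b + 𝟙 (b <? a) * X a b))
               (cong₂ _+_ (∑-δ-* a (X a))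
                          (∑-distrib-+ (λ b → 𝟙 (a <? b) * X a b) (λ b → 𝟙 (b <? a) * X a b))) ⟩
    X a a + (upper a + lower a)
      ∎
    where
    split : ∀ b → X a b ≡ δ b a * X a b + (𝟙 (a <? b) * X a b + 𝟙 (b <? a) * X a b)
    split b = begin
      X a b
        ≡⟨ sym (*-identityˡ (X a b)) ⟩
      1 * X a b
        ≡⟨ cong (_* X a b) (sym (trichotomy a b)) ⟩
      (δ b a + (𝟙 (a <? b) + 𝟙 (b <? a))) * X a b
        ≡⟨ *-distribʳ-+ (X a b) (δ b a) _ ⟩
      δ b a * X a b + (𝟙 (a <? b) + 𝟙 (b <? a)) * X a b
        ≡⟨ cong (δ b a * X a b +_) (*-distribʳ-+ (X a b) (𝟙 (a <? b)) _) ⟩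
      δ b a * X a b + (𝟙 (a <? b) * X a b + 𝟙 (b <? a) * X a b)
        ∎

  lower≡upper : sum lower ≡ sum upper
  lower≡upper = trans (∑-comm (λ a b → 𝟙 (b <? a) * X a b))
                      (sum-cong-≗ λ b → sum-cong-≗ λ a → cong (𝟙 (b <? a) *_) (X-sym a b))

3*t≤t*t+2 : ∀ t → 3 * t ≤ t * t + 2
3*t≤t*t+2 0 = ℕ.z≤n
3*t≤t*t+2 1 = ≤-refl
3*t≤t*t+2 2 = ≤-refl
3*t≤t*t+2 t@(ℕ.suc (ℕ.suc (ℕ.suc _))) =
  ≤-trans (*-monoˡ-≤ t {3} {t} (ℕ.s≤s (ℕ.s≤s (ℕ.s≤s ℕ.z≤n)))) (m≤m+n (t * t) 2)

∑-square-lowerBound : (T : Fin n → ℕ) (i : Fin n) →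
                      3 * sum T + T i * T i ≤ ∑[ c < n ] (T c * T c) + 2 * n + 3 * T i
∑-square-lowerBound {n} T i = begin
  3 * sum T + T i * T i
    ≡⟨ cong (3 * sum T +_) (sym (∑-δ-* i (λ c → T c * T c))) ⟩
  3 * sum T + ∑[ c < n ] (δ c i * (T c * T c))
    ≡⟨ sym (∑-*ˡ-+ 3 T (λ c → δ c i * (T c * T c))) ⟩
  ∑[ c < n ] (3 * T c + δ c i * (T c * T c))
    ≤⟨ ∑-mono-≤ pointwise ⟩
  ∑[ c < n ] (T c * T c + 2 + δ c i * (3 * T c))
    ≡⟨ ∑-distrib-+ (λ c → T c * T c + 2) (λ c → δ c i * (3 * T c)) ⟩
  ∑[ c < n ] (T c * T c + 2) + ∑[ c < n ] (δ c i * (3 * T c))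
    ≡⟨ cong₂ _+_ (trans (∑-distrib-+ (λ c → T c * T c) (λ _ → 2))
                        (cong (∑[ c < n ] (T c * T c) +_) (trans (∑-const n 2) (*-comm n 2))))
                 (∑-δ-* i (λ c → 3 * T c)) ⟩
  ∑[ c < n ] (T c * T c) + 2 * n + 3 * T i
    ∎
  where
  open ≤-Reasoning
  at-i : ∀ t → 3 * t + 1 * (t * t) + 2 ≡ t * t + 2 + 1 * (3 * t)
  at-i = solve-∀

  pointwise : ∀ c → 3 * T c + δ c i * (T c * T c) ≤ T c * T c + 2 + δ c i * (3 * T c)
  pointwise c with c ≟ i
  ... | yes _ = ≤-trans (m≤m+n _ 2) (≤-reflexive (at-i (T c)))
  ... | no _  = +-monoˡ-≤ 0 (3*t≤t*t+2 (T c))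

4[r≡2]+r²≤4r+5[r≡5] : ∀ r → r ≤ 5 → 4 * 𝟙 (r ℕ.≟ 2) + r * r ≤ 4 * r + 5 * 𝟙 (r ℕ.≟ 5)
4[r≡2]+r²≤4r+5[r≡5] 0 _ = ℕ.z≤n
4[r≡2]+r²≤4r+5[r≡5] 1 _ = m≤m+n 1 3
4[r≡2]+r²≤4r+5[r≡5] 2 _ = ≤-refl
4[r≡2]+r²≤4r+5[r≡5] 3 _ = m≤m+n 9 3
4[r≡2]+r²≤4r+5[r≡5] 4 _ = ≤-refl
4[r≡2]+r²≤4r+5[r≡5] 5 _ = ≤-refl
4[r≡2]+r²≤4r+5[r≡5] (ℕ.suc (ℕ.suc (ℕ.suc (ℕ.suc (ℕ.suc (ℕ.suc k)))))) r≤5 =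
  contradiction r≤5 (<⇒≱ (m≤m+n 6 k))

∑-weighted-≤ : (r : Fin n → ℕ) → (∀ i → r i ≤ 5) →
               4 * ∑[ i < n ] 𝟙 (r i ℕ.≟ 2) + ∑[ i < n ] (r i * r i) ≤
               4 * sum r + 5 * ∑[ i < n ] 𝟙 (r i ℕ.≟ 5)
∑-weighted-≤ {n} r r≤5 = begin
  4 * ∑[ i < n ] 𝟙 (r i ℕ.≟ 2) + ∑[ i < n ] (r i * r i)
    ≡⟨ sym (∑-*ˡ-+ 4 (λ i → 𝟙 (r i ℕ.≟ 2)) (λ i → r i * r i)) ⟩
  ∑[ i < n ] (4 * 𝟙 (r i ℕ.≟ 2) + r i * r i)
    ≤⟨ ∑-mono-≤ (λ i → 4[r≡2]+r²≤4r+5[r≡5] (r i) (r≤5 i)) ⟩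
  ∑[ i < n ] (4 * r i + 5 * 𝟙 (r i ℕ.≟ 5))
    ≡⟨ ∑-*ˡ-+ 4 r (λ i → 5 * 𝟙 (r i ℕ.≟ 5)) ⟩
  4 * sum r + ∑[ i < n ] (5 * 𝟙 (r i ℕ.≟ 5))
    ≡⟨ cong (4 * sum r +_) (sym (*-distribˡ-sum 5 (λ i → 𝟙 (r i ℕ.≟ 5)))) ⟩
  4 * sum r + 5 * ∑[ i < n ] 𝟙 (r i ℕ.≟ 5)
    ∎
  where open ≤-Reasoning

m+2n≡1+2k⇒0<m : ∀ m n k → m + 2 * n ≡ ℕ.suc (2 * k) → 0 < m
m+2n≡1+2k⇒0<m 0           n k eq = contradiction eq (even≢odd n k)
m+2n≡1+2k⇒0<m (ℕ.suc _) _ _ _  = ℕ.s≤s ℕ.z≤n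

2c₂≤m+4N : ∀ {c₂ c₅ N E m} →
           4 * c₂ + E ≤ 4 * (N * N) + 5 * c₅ →
           3 * (N * N) + N * N ≤ E + 2 * m + 3 * N →
           c₅ ≤ N →
           2 * c₂ ≤ m + 4 * N
2c₂≤m+4N {c₂} {c₅} {N} {E} {m} weighted energy c₅≤N = *-cancelˡ-≤ 2 (+-cancelʳ-≤ E _ _ (begin
  2 * (2 * c₂) + E
    ≡⟨ cong (_+ E) (sym (*-assoc 2 2 c₂)) ⟩
  4 * c₂ + E
    ≤⟨ weighted ⟩
  4 * (N * N) + 5 * c₅
    ≤⟨ +-monoʳ-≤ (4 * (N * N)) (*-monoʳ-≤ 5 c₅≤N) ⟩
  4 * (N * N) + 5 * N
    ≡⟨ solve (N ∷ []) ⟩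
  3 * (N * N) + N * N + 5 * N
    ≤⟨ +-monoˡ-≤ (5 * N) energy ⟩
  E + 2 * m + 3 * N + 5 * N
    ≡⟨ solve (E ∷ m ∷ N ∷ []) ⟩
  2 * (m + 4 * N) + E
    ∎))
  where open ≤-Reasoning

[2c∸m]²≤180m : ∀ {c m N} → 2 * c ≤ m + 4 * N → N * N ≤ 5 * m →
               (2 * c ∸ m) * (2 * c ∸ m) ≤ 180 * m
[2c∸m]²≤180m {c} {m} {N} 2c≤m+4N N²≤5m = begin
  (2 * c ∸ m) * (2 * c ∸ m)
    ≤⟨ *-mono-≤ 2c∸m≤4N 2c∸m≤4N ⟩
  (4 * N) * (4 * N)
    ≡⟨ [m*n]*[o*p]≡[m*o]*[n*p] 4 N 4 N ⟩
  16 * (N * N)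
    ≤⟨ *-monoʳ-≤ 16 N²≤5m ⟩
  16 * (5 * m)
    ≡⟨ sym (*-assoc 16 5 m) ⟩
  80 * m
    ≤⟨ *-monoˡ-≤ m (m≤m+n 80 100) ⟩
  180 * m
    ∎
  where
  open ≤-Reasoning
  2c∸m≤4N : 2 * c ∸ m ≤ 4 * N
  2c∸m≤4N = ≤-trans (∸-monoˡ-≤ m 2c≤m+4N) (≤-reflexive (m+n∸m≡n m (4 * N)))

module Convolution {m : ℕ} (G : FinAbGroup m) where
  open FinAbGroup G
  open IsAbelianGroup isAbelianGroup using (isGroup; assoc; comm; identityˡ)

  group : Group _ _
  group = record { isGroup = isGroup }

  open Group group public using (_\\_)
  open GroupProperties group using (\\-leftDividesˡ; \\-leftDividesʳ)

  translation : Fin m → Permutation m m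
  translation c = permutation (c ∙_) (c \\_) (\\-leftDividesˡ c) (\\-leftDividesʳ c)

  ∑-translate : ∀ c (f : Fin m → ℕ) → sum f ≡ ∑[ h < m ] f (c ∙ h)
  ∑-translate c f = ∑-permute f (translation c)

  δ-∙ : ∀ a b g → δ (a ∙ b) g ≡ δ b (a \\ g)
  δ-∙ a b g = 𝟙-cong (a ∙ b ≟ g) (b ≟ a \\ g)
    (λ ab≡g → trans (sym (\\-leftDividesʳ a b)) (cong (a \\_) ab≡g))
    (λ b≡a\\g → trans (cong (a ∙_) b≡a\\g) (\\-leftDividesˡ a g))

  infixl 7 _⋆_
  _⋆_ : (Fin m → ℕ) → (Fin m → ℕ) → Fin m → ℕ
  (f ⋆ g) x = ∑[ a < m ] (f a * g (a \\ x))

  autocorrelation : (Fin m → ℕ) → Fin m → ℕ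
  autocorrelation f x = ∑[ h < m ] (f h * f (x ∙ h))

  ∑-⋆ : (f g : Fin m → ℕ) → sum (f ⋆ g) ≡ sum f * sum g
  ∑-⋆ f g = begin
    ∑[ x < m ] ∑[ a < m ] (f a * g (a \\ x))
      ≡⟨ ∑-comm (λ x a → f a * g (a \\ x)) ⟩
    ∑[ a < m ] ∑[ x < m ] (f a * g (a \\ x))
      ≡⟨ sum-cong-≗ (λ a → trans (sym (*-distribˡ-sum (f a) (λ x → g (a \\ x))))
                                 (cong (f a *_) (sym (∑-translate (a ⁻¹) g)))) ⟩
    ∑[ a < m ] (f a * sum g)
      ≡⟨ sym (*-distribʳ-sum (sum g) f) ⟩
    sum f * sum g
      ∎
    where open ≡-Reasoning

  ∑-autocorrelation : (f : Fin m → ℕ) → sum (autocorrelation f) ≡ sum f * sum f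
  ∑-autocorrelation f = begin
    ∑[ x < m ] ∑[ h < m ] (f h * f (x ∙ h))
      ≡⟨ ∑-comm (λ x h → f h * f (x ∙ h)) ⟩
    ∑[ h < m ] ∑[ x < m ] (f h * f (x ∙ h))
      ≡⟨ sum-cong-≗ (λ h → trans (sym (*-distribˡ-sum (f h) (λ x → f (x ∙ h))))
                                 (cong (f h *_) (trans (sum-cong-≗ λ x → cong f (comm x h))
                                                       (sym (∑-translate h f))))) ⟩
    ∑[ h < m ] (f h * sum f)
      ≡⟨ sym (*-distribʳ-sum (sum f) f) ⟩
    sum f * sum f
      ∎
    where open ≡-Reasoning

  autocorrelation-ε : (f : Fin m → ℕ) → autocorrelation f ε ≡ ∑[ h < m ] (f h * f h)
  autocorrelation-ε f = sum-cong-≗ λ h → cong (λ y → f h * f y) (identityˡ h)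

  -- Both sides count the quadruples a + a' = b + b', the left by the common sum,
  -- the right by the difference a - b' = b - a'.
  ∑-⋆² : (f : Fin m → ℕ) →
         ∑[ x < m ] ((f ⋆ f) x * (f ⋆ f) x) ≡ ∑[ d < m ] (autocorrelation f d * autocorrelation f d)
  ∑-⋆² f = begin
    ∑[ x < m ] ((f ⋆ f) x * (f ⋆ f) x)
      ≡⟨ sum-cong-≗ (λ x → trans (*-distribʳ-sum ((f ⋆ f) x) (λ a → f a * f (a \\ x)))
                                 (sum-cong-≗ λ a →
                                   *-distribˡ-sum (f a * f (a \\ x)) (λ b → f b * f (b \\ x)))) ⟩
    ∑[ x < m ] ∑[ a < m ] ∑[ b < m ] term a b x
      ≡⟨ trans (∑-comm (λ x a → ∑[ b < m ] term a b x))
               (sum-cong-≗ λ a → ∑-comm (λ x b → term a b x)) ⟩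
    ∑[ a < m ] ∑[ b < m ] ∑[ x < m ] term a b x
      ≡⟨ sum-cong-≗ (λ a → sum-cong-≗ (λ b → ∑-term a b)) ⟩
    ∑[ a < m ] ∑[ b < m ] ((f a * f b) * autocorrelation f (b \\ a))
      ≡⟨ ∑-comm (λ a b → (f a * f b) * autocorrelation f (b \\ a)) ⟩
    ∑[ b < m ] ∑[ a < m ] ((f a * f b) * autocorrelation f (b \\ a))
      ≡⟨ sum-cong-≗ (λ b → trans (∑-translate b (λ a → (f a * f b) * autocorrelation f (b \\ a)))
                                 (sum-cong-≗ λ d → shift b d)) ⟩
    ∑[ b < m ] ∑[ d < m ] (autocorrelation f d * (f b * f (d ∙ b)))
      ≡⟨ ∑-comm (λ b d → autocorrelation f d * (f b * f (d ∙ b))) ⟩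
    ∑[ d < m ] ∑[ b < m ] (autocorrelation f d * (f b * f (d ∙ b)))
      ≡⟨ sum-cong-≗ (λ d → sym (*-distribˡ-sum (autocorrelation f d) (λ b → f b * f (d ∙ b)))) ⟩
    ∑[ d < m ] (autocorrelation f d * autocorrelation f d)
      ∎
    where
    open ≡-Reasoning
    term : Fin m → Fin m → Fin m → ℕ
    term a b x = (f a * f (a \\ x)) * (f b * f (b \\ x))

    ∑-term : ∀ a b → ∑[ x < m ] term a b x ≡ (f a * f b) * autocorrelation f (b \\ a)
    ∑-term a b = begin
      ∑[ x < m ] term a b x
        ≡⟨ ∑-translate a (term a b) ⟩
      ∑[ h < m ] ((f a * f (a \\ (a ∙ h))) * (f b * f (b \\ (a ∙ h))))
        ≡⟨ sum-cong-≗ (λ h → trans ([m*n]*[o*p]≡[m*o]*[n*p] (f a) _ (f b) _)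
             (cong ((f a * f b) *_)
                   (cong₂ (λ y z → f y * f z) (\\-leftDividesʳ a h) (sym (assoc (b ⁻¹) a h))))) ⟩
      ∑[ h < m ] ((f a * f b) * (f h * f ((b \\ a) ∙ h)))
        ≡⟨ sym (*-distribˡ-sum (f a * f b) (λ h → f h * f ((b \\ a) ∙ h))) ⟩
      (f a * f b) * autocorrelation f (b \\ a)
        ∎

    shift : ∀ b d → (f (b ∙ d) * f b) * autocorrelation f (b \\ (b ∙ d)) ≡
                    autocorrelation f d * (f b * f (d ∙ b))
    shift b d = begin
      (f (b ∙ d) * f b) * autocorrelation f (b \\ (b ∙ d))
        ≡⟨ cong₂ (λ y z → (f y * f b) * autocorrelation f z) (comm b d) (\\-leftDividesʳ b d) ⟩
      (f (d ∙ b) * f b) * autocorrelation f d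
        ≡⟨ *-comm (f (d ∙ b) * f b) (autocorrelation f d) ⟩
      autocorrelation f d * (f (d ∙ b) * f b)
        ≡⟨ cong (autocorrelation f d *_) (*-comm (f (d ∙ b)) (f b)) ⟩
      autocorrelation f d * (f b * f (d ∙ b))
        ∎

module Representation {m : ℕ} (G : FinAbGroup m) (A : Subset m) where
  open FinAbGroup G
  open IsAbelianGroup isAbelianGroup using (comm)
  open Convolution G

  χ : Fin m → ℕ
  χ a = 𝟙 (a ∈? A)

  ∣A∣ : ℕ
  ∣A∣ = sum χ

  representation : Fin m → Fin m → Fin m → ℕ
  representation g a b = χ a * (χ b * δ (a ∙ b) g)

  R≡∑∑representation : ∀ g → R G A g ≡ ∑[ a < m ] ∑[ b < m ] representation g a b
  R≡∑∑representation g =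
    trans (length-filter-allFin² {n = m} {m = m} _)
          (sum-cong-≗ λ a → sum-cong-≗ λ b →
            trans (𝟙-× (a ∈? A) ((b ∈? A) ×-dec (a ∙ b ≟ g)))
                  (cong (χ a *_) (𝟙-× (b ∈? A) (a ∙ b ≟ g))))

  R≡χ⋆χ : ∀ g → R G A g ≡ (χ ⋆ χ) g
  R≡χ⋆χ g = trans (R≡∑∑representation g) (sum-cong-≗ λ a → begin
    ∑[ b < m ] (χ a * (χ b * δ (a ∙ b) g))
      ≡⟨ sym (*-distribˡ-sum (χ a) (λ b → χ b * δ (a ∙ b) g)) ⟩
    χ a * ∑[ b < m ] (χ b * δ (a ∙ b) g)
      ≡⟨ cong (χ a *_) (sum-cong-≗ λ b → trans (cong (χ b *_) (δ-∙ a b g)) (*-comm (χ b) _)) ⟩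
    χ a * ∑[ b < m ] (δ b (a \\ g) * χ b)
      ≡⟨ cong (χ a *_) (∑-δ-* (a \\ g) χ) ⟩
    χ a * χ (a \\ g)
      ∎)
    where open ≡-Reasoning

  halves : Fin m → ℕ
  halves g = ∑[ a < m ] (χ a * δ (a ∙ a) g)

  R≡halves+2* : ∀ g → ∃[ t ] R G A g ≡ halves g + 2 * t
  R≡halves+2* g = offDiagonal , (begin
    R G A g
      ≡⟨ R≡∑∑representation g ⟩
    ∑[ a < m ] ∑[ b < m ] representation g a b
      ≡⟨ ∑∑-symmetric (representation g) representation-sym ⟩
    ∑[ a < m ] representation g a a + 2 * offDiagonal
      ≡⟨ cong (_+ 2 * offDiagonal) (sum-cong-≗ diagonal) ⟩
    halves g + 2 * offDiagonal
      ∎)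
    where
    open ≡-Reasoning
    offDiagonal : ℕ
    offDiagonal = ∑[ a < m ] ∑[ b < m ] (𝟙 (a <? b) * representation g a b)

    diagonal : ∀ a → representation g a a ≡ χ a * δ (a ∙ a) g
    diagonal a = trans (sym (*-assoc (χ a) (χ a) _)) (cong (_* δ (a ∙ a) g) (𝟙-idem (a ∈? A)))

    representation-sym : ∀ a b → representation g a b ≡ representation g b a
    representation-sym a b = trans (*-comm (χ a) _)
      (trans (*-assoc (χ b) (δ (a ∙ b) g) (χ a))
             (cong (χ b *_) (trans (*-comm (δ (a ∙ b) g) (χ a)) (cong (λ x → χ a * δ x g) (comm a b)))))

  ∑-halves : sum halves ≡ ∣A∣
  ∑-halves = begin
    ∑[ g < m ] ∑[ a < m ] (χ a * δ (a ∙ a) g)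
      ≡⟨ ∑-comm (λ g a → χ a * δ (a ∙ a) g) ⟩
    ∑[ a < m ] ∑[ g < m ] (χ a * δ (a ∙ a) g)
      ≡⟨ sum-cong-≗ (λ a → trans (sym (*-distribˡ-sum (χ a) (δ (a ∙ a))))
                                 (cong (χ a *_) (∑-δ (a ∙ a)))) ⟩
    ∑[ a < m ] (χ a * 1)
      ≡⟨ sum-cong-≗ (λ a → *-identityʳ (χ a)) ⟩
    ∣A∣
      ∎
    where open ≡-Reasoning

  #R≡ : ℕ → ℕ
  #R≡ k = ∑[ g < m ] 𝟙 (R G A g ℕ.≟ k)

  energy : ℕ
  energy = ∑[ g < m ] (R G A g * R G A g)

  countR2≡#R≡2 : countR2 G A ≡ #R≡ 2
  countR2≡#R≡2 = length-filter-allFin (λ g → R G A g ℕ.≟ 2)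

  #R≡5≤∣A∣ : #R≡ 5 ≤ ∣A∣
  #R≡5≤∣A∣ = ≤-trans (∑-mono-≤ 𝟙[R≡5]≤halves) (≤-reflexive ∑-halves)
    where
    𝟙[R≡5]≤halves : ∀ g → 𝟙 (R G A g ℕ.≟ 5) ≤ halves g
    𝟙[R≡5]≤halves g with R≡halves+2* g
    ... | t , R≡h+2*t = 𝟙-≤ (R G A g ℕ.≟ 5) λ R≡5 →
      m+2n≡1+2k⇒0<m (halves g) t 2 (trans (sym R≡h+2*t) R≡5)

  ∑R≡∣A∣² : sum (R G A) ≡ ∣A∣ * ∣A∣
  ∑R≡∣A∣² = trans (sum-cong-≗ R≡χ⋆χ) (∑-⋆ χ χ)

  energy-lowerBound : 3 * (∣A∣ * ∣A∣) + ∣A∣ * ∣A∣ ≤ energy + 2 * m + 3 * ∣A∣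
  energy-lowerBound = begin
    3 * (∣A∣ * ∣A∣) + ∣A∣ * ∣A∣
      ≡⟨ cong₂ (λ s t → 3 * s + t * t) (sym (∑-autocorrelation χ)) (sym autocorrelation-χ-ε) ⟩
    3 * sum T + T ε * T ε
      ≤⟨ ∑-square-lowerBound T ε ⟩
    ∑[ d < m ] (T d * T d) + 2 * m + 3 * T ε
      ≡⟨ cong₂ (λ E t → E + 2 * m + 3 * t) (sym energy≡∑T²) autocorrelation-χ-ε ⟩
    energy + 2 * m + 3 * ∣A∣
      ∎
    where
    open ≤-Reasoning
    T : Fin m → ℕ
    T = autocorrelation χ

    autocorrelation-χ-ε : T ε ≡ ∣A∣
    autocorrelation-χ-ε = trans (autocorrelation-ε χ) (sum-cong-≗ λ a → 𝟙-idem (a ∈? A))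

    energy≡∑T² : energy ≡ ∑[ d < m ] (T d * T d)
    energy≡∑T² = trans (sum-cong-≗ λ g → cong₂ _*_ (R≡χ⋆χ g) (R≡χ⋆χ g)) (∑-⋆² χ)

  module _ (R≤5 : ∀ g → R G A g ≤ 5) where

    weighted-count : 4 * #R≡ 2 + energy ≤ 4 * (∣A∣ * ∣A∣) + 5 * #R≡ 5
    weighted-count =
      subst (λ s → 4 * #R≡ 2 + energy ≤ 4 * s + 5 * #R≡ 5) ∑R≡∣A∣² (∑-weighted-≤ (R G A) R≤5)

    ∣A∣²≤5m : ∣A∣ * ∣A∣ ≤ 5 * m
    ∣A∣²≤5m = begin
      ∣A∣ * ∣A∣    ≡⟨ sym ∑R≡∣A∣² ⟩
      sum (R G A)  ≤⟨ ∑-mono-≤ R≤5 ⟩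
      ∑[ g < m ] 5 ≡⟨ trans (∑-const m 5) (*-comm m 5) ⟩
      5 * m        ∎
      where open ≤-Reasoning

theorem1p2 : (m : ℕ) (G : FinAbGroup m) (A : Subset m) →
    (∀ (g : Fin m) → R G A g ≤ 5) →
    (2 * countR2 G A ∸ m) * (2 * countR2 G A ∸ m) ≤ 180 * m
theorem1p2 m G A R≤5 =
  subst (λ c → (2 * c ∸ m) * (2 * c ∸ m) ≤ 180 * m) (sym countR2≡#R≡2)
        ([2c∸m]²≤180m {#R≡ 2} {m} {∣A∣}
          (2c₂≤m+4N {#R≡ 2} {#R≡ 5} {∣A∣} {energy} {m}
            (weighted-count R≤5) energy-lowerBound #R≡5≤∣A∣)
          (∣A∣²≤5m R≤5))
  where open Representation G A
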